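{- Let $k\ge 1$ be an odd integer, let $GC_k(x,q)=\sum_{n\ge 0}\sum_{\pi\in[k]^n}x^nq^{\mathrm{gkcon}(\pi)}$, and put $b=x(q-1)$. Then $$GC_k(x,q)=\frac{\displaystyle\sum_{i=0}^{k}(-1)^{\lfloor\frac{i+1}{2}\rfloor}\binom{\lfloor\frac{k-i}{2}\rfloor+i}{i}b^i}{\displaystyle\sum_{i=0}^{k}(-1)^{\lfloor\frac{i+1}{2}\rfloor}\binom{\lfloor\frac{k-i}{2}\rfloor+i}{i}b^i-x\sum_{j=0}^{k-1}\left(1+(-1)^{\lfloor\frac{j+1}{2}\rfloor}\sum_{i=1}^{j}(-1)^{\lfloor\frac{j-i+1}{2}\rfloor}\binom{\lfloor\frac{j-i}{2}\rfloor+i}{i}b^i\right)}.$$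
   Context: $[k]=\{1,2,\ldots,k\}$, and $[k]^n$ is the set of words $\pi=\pi_1\cdots\pi_n$ of length $n$ over $[k]$ (including the empty word for $n=0$). A gk-connector of $\pi$ is an index $j$ with $1\le j\le n-1$ and $\pi_j+\pi_{j+1}>k$; $\mathrm{gkcon}(\pi)$ is the number of gk-connectors of $\pi$. -}

module Defs where

open import Data.Nat using (ℕ; zero; suc; _+_; _∸_; _<ᵇ_; _/_)
open import Data.Nat.Combinatorics using (_C_)
open import Data.Integer as ℤ using (ℤ; +_; -_)
open import Data.Fin using (Fin; toℕ)
open import Data.Vec using (Vec; []; _∷_)
open import Data.List using (List; [_]; map; concatMap; allFin; filter; length)
open import Data.Bool using (if_then_else_)
open import Data.Product using (∃)
open import Relation.Binary.PropositionalEquality using (_≡_)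
open import Data.Nat.Properties using (_≟_)
open import Relation.Nullary using (yes; no)

Odd : ℕ → Set
Odd k = ∃ λ t → k ≡ suc (t + t)

-- letters of [k] are represented by Fin k, letter value = toℕ a + 1
val : ∀ {k} → Fin k → ℕ
val a = suc (toℕ a)

gkcon : ∀ {k n} → Vec (Fin k) n → ℕ
gkcon [] = 0
gkcon (a ∷ []) = 0
gkcon {k} (a ∷ b ∷ w) = (if k <ᵇ (val a + val b) then 1 else 0) + gkcon (b ∷ w)

words : ∀ k n → List (Vec (Fin k) n)
words k zero = [ [] ]
words k (suc n) = concatMap (λ a → map (a ∷_) (words k n)) (allFin k)

-- formal power series in x, q with integer coefficients:
-- s n m is the coefficient of x^n q^m
Series : Set
Series = ℕ → ℕ → ℤ

sumℤ : ℕ → (ℕ → ℤ) → ℤ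
sumℤ zero f = + 0
sumℤ (suc n) f = sumℤ n f ℤ.+ f n

_⊕_ : Series → Series → Series
(f ⊕ g) n m = f n m ℤ.+ g n m

_⊖_ : Series → Series → Series
(f ⊖ g) n m = f n m ℤ.- g n m

_⊗_ : Series → Series → Series
(f ⊗ g) n m = sumℤ (suc n) λ a → sumℤ (suc m) λ c → f a c ℤ.* g (n ∸ a) (m ∸ c)

scale : ℤ → Series → Series
scale z f n m = z ℤ.* f n m

mono : ℕ → ℕ → Series
mono a c n m with n ≟ a | m ≟ c
... | yes _ | yes _ = + 1
... | _ | _ = + 0

one X Q : Series
one = mono 0 0
X = mono 1 0
Q = mono 0 1

_^s_ : Series → ℕ → Series
f ^s zero = one
f ^s suc i = f ⊗ (f ^s i)

sumS : ℕ → (ℕ → Series) → Series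
sumS zero f = λ _ _ → + 0
sumS (suc n) f = sumS n f ⊕ f n

sgn : ℕ → ℤ
sgn zero = + 1
sgn (suc m) = - sgn m

GC : ℕ → Series
GC k n m = + length (filter (λ w → gkcon w ≟ m) (words k n))

bS : Series
bS = X ⊗ (Q ⊖ one)

Num : ℕ → Series
Num k = sumS (suc k) λ i → scale (sgn ((i + 1) / 2) ℤ.* + (((k ∸ i) / 2 + i) C i)) (bS ^s i)

inner : ℕ → Series
inner j = one ⊕ scale (sgn ((j + 1) / 2))
  (sumS j λ i' → let i = suc i' in
     scale (sgn ((j ∸ i + 1) / 2) ℤ.* + (((j ∸ i) / 2 + i) C i)) (bS ^s i))

Den : ℕ → Series
Den k = Num k ⊖ (X ⊗ sumS k inner)

-- Write k = 2t + 1, number the letters 0, …, 2t, and let U_i be the generating function of the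
-- nonempty words starting with letter i. Splitting off the first letter gives GC = 1 + Σ_i U_i and
-- U_i = x (1 + Σ_j w_ij U_j), where w_ij = q if i + j ≥ 2t (the two letters form a gk-connector)
-- and w_ij = 1 otherwise; with b = x(q - 1) this reads U_i = x GC + b Σ_{i+j≥2t} U_j.
-- Let P_0 = P_1 = 1 and P_{n+2} = P_n + (-1)^{n+1} b P_{n+1}. The coefficients of P_n are the
-- signed binomial coefficients of the statement: the numerator is P_{k+1} and the j-th inner sum
-- of the denominator is P_{j+1}. The weights β_i = P_{2(t-i)} (i ≤ t), β_i = P_{2(i-t)+1} (i ≥ t)
-- satisfy β_j = P_{k+1} + b Σ_{i+j≥2t} β_i for every letter j: passing from j to j + 1 adds the
-- letter m = 2t - 1 - j to the window i + j ≥ 2t, and the recurrence of P, alternating sign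
-- included, says exactly that β_{j+1} = β_j + b β_m. Pairing the equations for U with β therefore
-- gives (GC - 1) P_{k+1} = x GC Σ_i β_i, and Σ_i β_i = Σ_{j<k} P_{j+1}.

module Submission where

open import Defs
open import Data.Nat using (ℕ)
open import Relation.Binary.PropositionalEquality using (_≡_)

import Data.Nat as ℕ
open import Data.Product using (_,_)
import Relation.Binary.PropositionalEquality as ≡
open import Algebra.Bundles using (CommutativeRing; Semiring)

module Summation {c ℓ} (R : CommutativeRing c ℓ) where

  open CommutativeRing R
  open import Data.Nat as ℕ using (zero; suc; _∸_; _<_)
  import Data.Nat.Properties as ℕₚ
  open import Relation.Binary.PropositionalEquality as ≡ using ()
  open import Relation.Binary.Reasoning.Setoid setoid
  open import Algebra.Properties.CommutativeSemigroup +-commutativeSemigroup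
    using (interchange; xy∙z≈xz∙y)

  ∑ : ℕ → (ℕ → Carrier) → Carrier
  ∑ zero    f = 0#
  ∑ (suc n) f = ∑ n f + f n

  ∑-cong< : ∀ n {f g : ℕ → Carrier} → (∀ i → i < n → f i ≈ g i) → ∑ n f ≈ ∑ n g
  ∑-cong< zero    f≈g = refl
  ∑-cong< (suc n) f≈g = +-cong (∑-cong< n (λ i i<n → f≈g i (ℕₚ.m<n⇒m<1+n i<n))) (f≈g n ℕₚ.≤-refl)

  ∑-cong : ∀ n {f g : ℕ → Carrier} → (∀ i → f i ≈ g i) → ∑ n f ≈ ∑ n g
  ∑-cong n f≈g = ∑-cong< n (λ i _ → f≈g i)

  ∑-zero : ∀ n {f : ℕ → Carrier} → (∀ i → i < n → f i ≈ 0#) → ∑ n f ≈ 0#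
  ∑-zero zero    f≈0 = refl
  ∑-zero (suc n) f≈0 =
    trans (+-cong (∑-zero n (λ i i<n → f≈0 i (ℕₚ.m<n⇒m<1+n i<n))) (f≈0 n ℕₚ.≤-refl)) (+-identityˡ 0#)

  ∑-distrib-+ : ∀ n (f g : ℕ → Carrier) → ∑ n (λ i → f i + g i) ≈ ∑ n f + ∑ n g
  ∑-distrib-+ zero    f g = sym (+-identityˡ 0#)
  ∑-distrib-+ (suc n) f g = begin
    ∑ n (λ i → f i + g i) + (f n + g n)  ≈⟨ +-congʳ (∑-distrib-+ n f g) ⟩
    (∑ n f + ∑ n g) + (f n + g n)        ≈⟨ interchange (∑ n f) (∑ n g) (f n) (g n) ⟩
    (∑ n f + f n) + (∑ n g + g n)        ∎

  *-distribˡ-∑ : ∀ n a (f : ℕ → Carrier) → a * ∑ n f ≈ ∑ n (λ i → a * f i)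
  *-distribˡ-∑ zero    a f = zeroʳ a
  *-distribˡ-∑ (suc n) a f = trans (distribˡ a (∑ n f) (f n)) (+-congʳ (*-distribˡ-∑ n a f))

  *-distribʳ-∑ : ∀ n a (f : ℕ → Carrier) → ∑ n f * a ≈ ∑ n (λ i → f i * a)
  *-distribʳ-∑ n a f = trans (*-comm _ a) (trans (*-distribˡ-∑ n a f) (∑-cong n (λ i → *-comm a (f i))))

  ∑-head : ∀ n (f : ℕ → Carrier) → ∑ (suc n) f ≈ f 0 + ∑ n (λ i → f (suc i))
  ∑-head zero    f = trans (+-identityˡ _) (sym (+-identityʳ _))
  ∑-head (suc n) f = trans (+-congʳ (∑-head n f)) (+-assoc _ _ _)

  ∑-split : ∀ m n (f : ℕ → Carrier) → ∑ (m ℕ.+ n) f ≈ ∑ m f + ∑ n (λ i → f (m ℕ.+ i))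
  ∑-split m zero    f = begin
    ∑ (m ℕ.+ 0) f  ≡⟨ ≡.cong (λ l → ∑ l f) (ℕₚ.+-identityʳ m) ⟩
    ∑ m f          ≈⟨ +-identityʳ _ ⟨
    ∑ m f + 0#     ∎
  ∑-split m (suc n) f = begin
    ∑ (m ℕ.+ suc n) f                                ≡⟨ ≡.cong (λ l → ∑ l f) (ℕₚ.+-suc m n) ⟩
    ∑ (m ℕ.+ n) f + f (m ℕ.+ n)                      ≈⟨ +-congʳ (∑-split m n f) ⟩
    (∑ m f + ∑ n (λ i → f (m ℕ.+ i))) + f (m ℕ.+ n)  ≈⟨ +-assoc _ _ _ ⟩
    ∑ m f + ∑ (suc n) (λ i → f (m ℕ.+ i))            ∎

  ∑-suffix : ∀ m n (f : ℕ → Carrier) → (∀ i → i < m → f i ≈ 0#) →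
             ∑ (m ℕ.+ n) f ≈ ∑ n (λ i → f (m ℕ.+ i))
  ∑-suffix m n f f≈0 = trans (∑-split m n f) (trans (+-congʳ (∑-zero m f≈0)) (+-identityˡ _))

  ∑-comm : ∀ m n (F : ℕ → ℕ → Carrier) → ∑ m (λ i → ∑ n (F i)) ≈ ∑ n (λ j → ∑ m (λ i → F i j))
  ∑-comm zero    n F = sym (∑-zero n (λ _ _ → refl))
  ∑-comm (suc m) n F =
    trans (+-congʳ (∑-comm m n F)) (sym (∑-distrib-+ n (λ j → ∑ m (λ i → F i j)) (F m)))

  ∑-reverse : ∀ n (f : ℕ → Carrier) → ∑ n f ≈ ∑ n (λ i → f (n ∸ suc i))
  ∑-reverse zero    f = refl
  ∑-reverse (suc n) f = begin
    ∑ n f + f n                          ≈⟨ +-comm _ _ ⟩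
    f n + ∑ n f                          ≈⟨ +-congˡ (∑-reverse n f) ⟩
    f n + ∑ n (λ i → f (n ∸ suc i))      ≈⟨ ∑-head n (λ i → f (suc n ∸ suc i)) ⟨
    ∑ (suc n) (λ i → f (suc n ∸ suc i))  ∎

  ∑-even-odd : ∀ t (f : ℕ → Carrier) →
               ∑ (suc (t ℕ.+ t)) f ≈ ∑ (suc t) (λ e → f (e ℕ.+ e)) + ∑ t (λ r → f (suc (r ℕ.+ r)))
  ∑-even-odd zero    f = sym (+-identityʳ _)
  ∑-even-odd (suc t) f = begin
    ∑ (suc (suc t ℕ.+ suc t)) f                     ≡⟨ ≡.cong (λ l → ∑ (suc l) f) (ℕₚ.+-suc (suc t) t) ⟩
    (∑ (suc (t ℕ.+ t)) f + f odd) + f even          ≈⟨ +-congʳ (+-congʳ (∑-even-odd t f)) ⟩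
    ((Evens + Odds) + f odd) + f even               ≈⟨ +-congʳ (+-assoc Evens Odds (f odd)) ⟩
    (Evens + (Odds + f odd)) + f even               ≈⟨ xy∙z≈xz∙y Evens (Odds + f odd) (f even) ⟩
    (Evens + f even) + (Odds + f odd)               ≡⟨ ≡.cong (λ l → (Evens + f (suc l)) + (Odds + f odd))
                                                               (ℕₚ.+-suc t t) ⟨
    (Evens + f (suc t ℕ.+ suc t)) + (Odds + f odd)  ∎
    where
    odd   = suc (t ℕ.+ t)
    even  = suc odd
    Evens = ∑ (suc t) (λ e → f (e ℕ.+ e))
    Odds  = ∑ t (λ r → f (suc (r ℕ.+ r)))

module PowerSeries {c ℓ} (R : CommutativeRing c ℓ) where

  open CommutativeRing R hiding (isCommutativeRing)
  open Summation R
  open import Algebra.Structures using (IsCommutativeRing)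
  open import Data.Nat using (zero; suc; _∸_; _<_)
  import Data.Nat.Properties as ℕₚ
  open import Relation.Binary.PropositionalEquality as ≡ using ()
  open import Relation.Binary.Reasoning.Setoid setoid

  R⟦x⟧ : Set c
  R⟦x⟧ = ℕ → Carrier

  record _≋_ (f g : R⟦x⟧) : Set ℓ where
    constructor coeffwise
    field coeff : ∀ n → f n ≈ g n
  open _≋_ public

  constₛ : Carrier → R⟦x⟧
  constₛ a zero    = a
  constₛ a (suc _) = 0#

  0ₛ 1ₛ Xₛ : R⟦x⟧
  0ₛ _ = 0#
  1ₛ = constₛ 1#
  Xₛ zero          = 0#
  Xₛ (suc zero)    = 1#
  Xₛ (suc (suc _)) = 0#

  tail : R⟦x⟧ → R⟦x⟧
  tail f n = f (suc n)

  _·ₛ_ : Carrier → R⟦x⟧ → R⟦x⟧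
  (a ·ₛ f) n = a * f n

  opaque
    _+ₛ_ : R⟦x⟧ → R⟦x⟧ → R⟦x⟧
    (f +ₛ g) n = f n + g n

    -ₛ_ : R⟦x⟧ → R⟦x⟧
    (-ₛ f) n = - f n

    _*ₛ_ : R⟦x⟧ → R⟦x⟧ → R⟦x⟧
    (f *ₛ g) n = ∑ (suc n) (λ i → f i * g (n ∸ i))

    +ₛ-coeff : ∀ f g n → (f +ₛ g) n ≡ f n + g n
    +ₛ-coeff f g n = ≡.refl

    -ₛ-coeff : ∀ f n → (-ₛ f) n ≡ - f n
    -ₛ-coeff f n = ≡.refl

    *ₛ-coeff : ∀ f g n → (f *ₛ g) n ≡ ∑ (suc n) (λ i → f i * g (n ∸ i))
    *ₛ-coeff f g n = ≡.refl

    *ₛ-cong : ∀ {f f′ g g′} → (∀ n → f n ≈ f′ n) → (∀ n → g n ≈ g′ n) →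
              ∀ n → (f *ₛ g) n ≈ (f′ *ₛ g′) n
    *ₛ-cong f≈f′ g≈g′ n = ∑-cong (suc n) (λ i → *-cong (f≈f′ i) (g≈g′ (n ∸ i)))

    *ₛ-comm : ∀ f g n → (f *ₛ g) n ≈ (g *ₛ f) n
    *ₛ-comm f g n = begin
      ∑ (suc n) (λ i → f i * g (n ∸ i))              ≈⟨ ∑-reverse (suc n) _ ⟩
      ∑ (suc n) (λ i → f (n ∸ i) * g (n ∸ (n ∸ i)))  ≈⟨ ∑-cong< (suc n) swap ⟩
      ∑ (suc n) (λ i → g i * f (n ∸ i))              ∎
      where
      swap : ∀ i → i < suc n → f (n ∸ i) * g (n ∸ (n ∸ i)) ≈ g i * f (n ∸ i)
      swap i i≤n = trans (*-comm _ _) (*-congʳ (reflexive (≡.cong g (ℕₚ.m∸[m∸n]≡n (ℕₚ.≤-pred i≤n)))))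

    *ₛ-distribˡ : ∀ f g h n → (f *ₛ (g +ₛ h)) n ≈ ((f *ₛ g) +ₛ (f *ₛ h)) n
    *ₛ-distribˡ f g h n = trans (∑-cong (suc n) (λ i → distribˡ (f i) _ _)) (∑-distrib-+ (suc n) _ _)

    *ₛ-distribʳ : ∀ f g h n → ((g +ₛ h) *ₛ f) n ≈ ((g *ₛ f) +ₛ (h *ₛ f)) n
    *ₛ-distribʳ f g h n = trans (∑-cong (suc n) (λ i → distribʳ (f (n ∸ i)) _ _)) (∑-distrib-+ (suc n) _ _)

    constₛ-* : ∀ a f n → (constₛ a *ₛ f) n ≈ a * f n
    constₛ-* a f n = begin
      ∑ (suc n) (λ i → constₛ a i * f (n ∸ i))  ≈⟨ ∑-head n _ ⟩
      a * f n + ∑ n (λ i → 0# * f (n ∸ suc i))  ≈⟨ +-congˡ (∑-zero n (λ i _ → zeroˡ _)) ⟩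
      a * f n + 0#                              ≈⟨ +-identityʳ _ ⟩
      a * f n                                   ∎

    *ₛ-identityˡ : ∀ f n → (1ₛ *ₛ f) n ≈ f n
    *ₛ-identityˡ f n = trans (constₛ-* 1# f n) (*-identityˡ _)

    Xₛ-*-zero : ∀ f → (Xₛ *ₛ f) 0 ≈ 0#
    Xₛ-*-zero f = trans (+-identityˡ _) (zeroˡ _)

    Xₛ-*-suc : ∀ f n → (Xₛ *ₛ f) (suc n) ≈ f n
    Xₛ-*-suc f n = begin
      ∑ (suc (suc n)) (λ i → Xₛ i * f (suc n ∸ i))
        ≈⟨ ∑-head (suc n) _ ⟩
      0# * f (suc n) + ∑ (suc n) (λ i → Xₛ (suc i) * f (n ∸ i))
        ≈⟨ trans (+-cong (zeroˡ _) (∑-head n _)) (+-identityˡ _) ⟩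
      1# * f n + ∑ n (λ i → 0# * f (n ∸ suc i))
        ≈⟨ +-cong (*-identityˡ _) (∑-zero n (λ i _ → zeroˡ _)) ⟩
      f n + 0#
        ≈⟨ +-identityʳ _ ⟩
      f n ∎

    *ₛ-zero : ∀ f g → (f *ₛ g) 0 ≈ f 0 * g 0
    *ₛ-zero f g = +-identityˡ _

    *ₛ-suc : ∀ f g n → (f *ₛ g) (suc n) ≈ f 0 * g (suc n) + (tail f *ₛ g) n
    *ₛ-suc f g n = ∑-head (suc n) _

    tail-*ₛ : ∀ f g n → tail (f *ₛ g) n ≈ ((f 0 ·ₛ tail g) +ₛ (tail f *ₛ g)) n
    tail-*ₛ = *ₛ-suc

    ·ₛ-*ₛ : ∀ a f g n → ((a ·ₛ f) *ₛ g) n ≈ a * (f *ₛ g) n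
    ·ₛ-*ₛ a f g n = sym (trans (*-distribˡ-∑ (suc n) a _) (∑-cong (suc n) (λ i → sym (*-assoc _ _ _))))

    *ₛ-assoc : ∀ f g h n → ((f *ₛ g) *ₛ h) n ≈ (f *ₛ (g *ₛ h)) n
    *ₛ-assoc f g h zero = begin
      ((f *ₛ g) *ₛ h) 0  ≈⟨ trans (*ₛ-zero (f *ₛ g) h) (*-congʳ (*ₛ-zero f g)) ⟩
      (f 0 * g 0) * h 0  ≈⟨ *-assoc _ _ _ ⟩
      f 0 * (g 0 * h 0)  ≈⟨ trans (*ₛ-zero f (g *ₛ h)) (*-congˡ (*ₛ-zero g h)) ⟨
      (f *ₛ (g *ₛ h)) 0  ∎
    *ₛ-assoc f g h (suc n) = begin
      ((f *ₛ g) *ₛ h) (suc n)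
        ≈⟨ *ₛ-suc (f *ₛ g) h n ⟩
      (f *ₛ g) 0 * h (suc n) + (tail (f *ₛ g) *ₛ h) n
        ≈⟨ +-cong (*-congʳ (*ₛ-zero f g)) (*ₛ-cong {g = h} (tail-*ₛ f g) (λ _ → refl) n) ⟩
      (f 0 * g 0) * h (suc n) + (((f 0 ·ₛ tail g) +ₛ (tail f *ₛ g)) *ₛ h) n
        ≈⟨ +-congˡ (*ₛ-distribʳ h _ _ n) ⟩
      (f 0 * g 0) * h (suc n) + (((f 0 ·ₛ tail g) *ₛ h) n + ((tail f *ₛ g) *ₛ h) n)
        ≈⟨ +-congˡ (+-cong (·ₛ-*ₛ (f 0) (tail g) h n) (*ₛ-assoc (tail f) g h n)) ⟩
      (f 0 * g 0) * h (suc n) + (f 0 * (tail g *ₛ h) n + (tail f *ₛ (g *ₛ h)) n)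
        ≈⟨ +-assoc _ _ _ ⟨
      ((f 0 * g 0) * h (suc n) + f 0 * (tail g *ₛ h) n) + (tail f *ₛ (g *ₛ h)) n
        ≈⟨ +-congʳ (trans (+-congʳ (*-assoc _ _ _)) (sym (distribˡ _ _ _))) ⟩
      f 0 * (g 0 * h (suc n) + (tail g *ₛ h) n) + (tail f *ₛ (g *ₛ h)) n
        ≈⟨ +-congʳ (*-congˡ (*ₛ-suc g h n)) ⟨
      f 0 * (g *ₛ h) (suc n) + (tail f *ₛ (g *ₛ h)) n
        ≈⟨ *ₛ-suc f (g *ₛ h) n ⟨
      (f *ₛ (g *ₛ h)) (suc n) ∎

    isCommutativeRing : IsCommutativeRing _≋_ _+ₛ_ _*ₛ_ -ₛ_ 0ₛ 1ₛ
    isCommutativeRing = record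
      { isRing = record
        { +-isAbelianGroup = record
          { isGroup = record
            { isMonoid = record
              { isSemigroup = record
                { isMagma = record
                  { isEquivalence = record
                    { refl  = coeffwise (λ n → refl)
                    ; sym   = λ f≋g → coeffwise (λ n → sym (coeff f≋g n))
                    ; trans = λ f≋g g≋h → coeffwise (λ n → trans (coeff f≋g n) (coeff g≋h n))
                    }
                  ; ∙-cong = λ f≋f′ g≋g′ → coeffwise (λ n → +-cong (coeff f≋f′ n) (coeff g≋g′ n))
                  }
                ; assoc = λ f g h → coeffwise (λ n → +-assoc (f n) (g n) (h n))
                }
              ; identity = (λ f → coeffwise (λ n → +-identityˡ (f n)))
                         , (λ f → coeffwise (λ n → +-identityʳ (f n)))
              }
            ; inverse = (λ f → coeffwise (λ n → -‿inverseˡ (f n)))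
                      , (λ f → coeffwise (λ n → -‿inverseʳ (f n)))
            ; ⁻¹-cong = λ f≋g → coeffwise (λ n → -‿cong (coeff f≋g n))
            }
          ; comm = λ f g → coeffwise (λ n → +-comm (f n) (g n))
          }
        ; *-cong = λ f≋f′ g≋g′ → coeffwise (*ₛ-cong (coeff f≋f′) (coeff g≋g′))
        ; *-assoc = λ f g h → coeffwise (*ₛ-assoc f g h)
        ; *-identity = (λ f → coeffwise (*ₛ-identityˡ f))
                     , (λ f → coeffwise (λ n → trans (*ₛ-comm f 1ₛ n) (*ₛ-identityˡ f n)))
        ; distrib = (λ f g h → coeffwise (*ₛ-distribˡ f g h))
                  , (λ f g h → coeffwise (*ₛ-distribʳ f g h))
        }
      ; *-comm = λ f g → coeffwise (*ₛ-comm f g)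
      }

  commutativeRing : CommutativeRing c ℓ
  commutativeRing = record { isCommutativeRing = isCommutativeRing }

  ∑ₛ-coeff : ∀ L (F : ℕ → R⟦x⟧) n → Summation.∑ commutativeRing L F n ≡ ∑ L (λ j → F j n)
  ∑ₛ-coeff zero    F n = ≡.refl
  ∑ₛ-coeff (suc L) F n = ≡.trans (+ₛ-coeff _ (F L) n) (≡.cong (_+ F L n) (∑ₛ-coeff L F n))

module WordCounts where

  open import Data.Nat as ℕ using (zero; suc; _<ᵇ_)
  open import Data.Nat.Properties using (_≟_; suc-injective)
  open import Data.Nat.ListAction using (sum)
  open import Data.Integer as ℤ using (ℤ; +_)
  import Data.Integer.Properties as ℤₚ
  open import Data.Bool using (Bool; true; false)
  open import Data.Fin using (Fin; toℕ) renaming (zero to fzero; suc to fsuc)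
  open import Data.Vec using (Vec; _∷_)
  open import Data.List using (List; []; _∷_; _++_; map; concatMap; allFin; filter; length; tabulate)
  import Data.List.Properties as Listₚ
  open import Data.List.Relation.Unary.All using (universal)
  open import Function using (_∘_)
  open import Level using (0ℓ)
  open import Relation.Nullary using (does)
  open import Relation.Unary using (Pred; Decidable)
  open import Relation.Binary.PropositionalEquality
  open ≡-Reasoning
  open Summation ℤₚ.+-*-commutativeRing

  linked : ℕ → ℕ → ℕ → Bool
  linked k i j = k <ᵇ suc i ℕ.+ suc j

  qIf : Bool → (ℕ → ℤ) → ℕ → ℤ
  qIf true  f zero    = + 0
  qIf true  f (suc m) = f m
  qIf false f m       = f m

  -- countFrom k i n m counts the words w ∈ [k]^n with gkcon ((i+1) w) = m: letters are numbered
  -- from 0, as by toℕ, and n is the length after the first letter.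
  countFrom : ℕ → ℕ → ℕ → ℕ → ℤ
  countFrom k i zero    zero    = + 1
  countFrom k i zero    (suc m) = + 0
  countFrom k i (suc n) m       = ∑ k (λ j → qIf (linked k i j) (countFrom k j n) m)

  count : {A : Set} {P : Pred A 0ℓ} → Decidable P → List A → ℕ
  count P? = length ∘ filter P?

  count-map : {A B : Set} {P : Pred B 0ℓ} (P? : Decidable P) (g : A → B) (xs : List A) →
              count P? (map g xs) ≡ count (P? ∘ g) xs
  count-map P? g []       = refl
  count-map P? g (x ∷ xs) with does (P? (g x))
  ... | false = count-map P? g xs
  ... | true  = cong suc (count-map P? g xs)

  count-concatMap : {A B : Set} {P : Pred B 0ℓ} (P? : Decidable P) (f : A → List B) (xs : List A) →
                    count P? (concatMap f xs) ≡ sum (map (count P? ∘ f) xs)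
  count-concatMap P? f []       = refl
  count-concatMap P? f (x ∷ xs) = begin
    length (filter P? (f x ++ concatMap f xs))
      ≡⟨ cong length (Listₚ.filter-++ P? (f x) _) ⟩
    length (filter P? (f x) ++ filter P? (concatMap f xs))
      ≡⟨ Listₚ.length-++ (filter P? (f x)) ⟩
    count P? (f x) ℕ.+ count P? (concatMap f xs)
      ≡⟨ cong (count P? (f x) ℕ.+_) (count-concatMap P? f xs) ⟩
    count P? (f x) ℕ.+ sum (map (count P? ∘ f) xs) ∎

  sum-tabulate : ∀ {A : Set} k (g : Fin k → A) (h : A → ℕ) (F : ℕ → ℤ) →
                 (∀ i → + h (g i) ≡ F (toℕ i)) → + sum (map h (tabulate g)) ≡ ∑ k F
  sum-tabulate zero    g h F h≡F = refl
  sum-tabulate (suc k) g h F h≡F = begin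
    + (h (g fzero) ℕ.+ sum (map h (tabulate (g ∘ fsuc))))
      ≡⟨ ℤₚ.pos-+ (h (g fzero)) _ ⟩
    + h (g fzero) ℤ.+ + sum (map h (tabulate (g ∘ fsuc)))
      ≡⟨ cong₂ ℤ._+_ (h≡F fzero) (sum-tabulate k (g ∘ fsuc) h (F ∘ suc) (h≡F ∘ fsuc)) ⟩
    F 0 ℤ.+ ∑ k (F ∘ suc)
      ≡⟨ ∑-head k F ⟨
    ∑ (suc k) F ∎

  count-by-head : ∀ k n {P : Pred (Vec (Fin k) (suc n)) 0ℓ} (P? : Decidable P) (F : ℕ → ℤ) →
                  (∀ a → + count (P? ∘ (a ∷_)) (words k n) ≡ F (toℕ a)) →
                  + count P? (words k (suc n)) ≡ ∑ k F
  count-by-head k n P? F count≡F = begin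
    + count P? (concatMap (λ a → map (a ∷_) (words k n)) (allFin k))
      ≡⟨ cong +_ (count-concatMap P? (λ a → map (a ∷_) (words k n)) (allFin k)) ⟩
    + sum (map (λ a → count P? (map (a ∷_) (words k n))) (allFin k))
      ≡⟨ sum-tabulate k (λ a → a) _ F (λ a → trans (cong +_ (count-map P? (a ∷_) (words k n))) (count≡F a)) ⟩
    ∑ k F ∎

  countFrom-correct : ∀ k (a : Fin k) n m →
                      + count (λ w → gkcon (a ∷ w) ≟ m) (words k n) ≡ countFrom k (toℕ a) n m
  count-after : ∀ k (a b : Fin k) n m →
                + count (λ w → gkcon (a ∷ b ∷ w) ≟ m) (words k n) ≡
                qIf (linked k (toℕ a) (toℕ b)) (countFrom k (toℕ b) n) m
  countFrom-correct k a zero    zero    = refl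
  countFrom-correct k a zero    (suc m) = refl
  countFrom-correct k a (suc n) m       = count-by-head k n _ _ (λ b → count-after k a b n m)
  count-after k a b n m with linked k (toℕ a) (toℕ b)
  ... | false = countFrom-correct k b n m
  count-after k a b n zero    | true = cong (+_ ∘ length) (Listₚ.filter-none _ (universal (λ _ ()) (words k n)))
  count-after k a b n (suc m) | true = begin
    + length (filter (λ w → suc (gkcon (b ∷ w)) ≟ suc m) (words k n))
      ≡⟨ cong (+_ ∘ length) (Listₚ.filter-≐ _ _ (suc-injective , cong suc) (words k n)) ⟩
    + count (λ w → gkcon (b ∷ w) ≟ m) (words k n)
      ≡⟨ countFrom-correct k b n m ⟩
    countFrom k (toℕ b) n m ∎

  GC-suc : ∀ k n m → GC k (suc n) m ≡ ∑ k (λ j → countFrom k j n m)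
  GC-suc k n m = count-by-head k n _ _ (λ a → countFrom-correct k a n m)

module TransferIdentity {c ℓ} (R : CommutativeRing c ℓ) (t : ℕ) where

  open CommutativeRing R
  open Summation R
  open WordCounts using (linked)
  open import Data.Nat as ℕ using (zero; suc; _∸_; _<_; _≤_; _<?_; s≤s)
  import Data.Nat.Properties as ℕₚ
  open import Data.Nat.Solver using (module +-*-Solver)
  open import Data.Bool using (true; false; if_then_else_)
  open import Data.Sum using (inj₁; inj₂)
  open import Relation.Nullary.Decidable using (dec-true; dec-false)
  open import Relation.Binary.PropositionalEquality as ≡ using (_≡_)
  open import Relation.Binary.Reasoning.Setoid setoid
  open import Algebra.Properties.CommutativeSemigroup *-commutativeSemigroup using (x∙yz≈y∙xz; x∙yz≈yx∙z)
  open import Algebra.Properties.Group +-group using (//-rightDividesʳ; quasigroup)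
  open import Algebra.Properties.Quasigroup quasigroup using (cancelʳ)
  open import Algebra.Properties.Ring ring using (-‿distribʳ-*)

  k : ℕ
  k = suc (t ℕ.+ t)

  linked-true : ∀ i j → t ℕ.+ t ≤ i ℕ.+ j → linked k i j ≡ true
  linked-true i j 2t≤i+j =
    dec-true (k <? suc i ℕ.+ suc j) (s≤s (ℕₚ.≤-trans (s≤s 2t≤i+j) (ℕₚ.≤-reflexive (≡.sym (ℕₚ.+-suc i j)))))

  linked-false : ∀ i j → i ℕ.+ j < t ℕ.+ t → linked k i j ≡ false
  linked-false i j i+j<2t =
    dec-false (k <? suc i ℕ.+ suc j) (ℕₚ.≤⇒≯ (s≤s (ℕₚ.≤-trans (ℕₚ.≤-reflexive (ℕₚ.+-suc i j)) i+j<2t)))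

  mirror-upper : ∀ e m → suc (t ℕ.+ e) ℕ.+ m ≡ t ℕ.+ t → m ℕ.+ suc e ≡ t
  mirror-upper e m eq = ℕₚ.+-cancelˡ-≡ t _ _ (≡.trans (reorder t e m) eq)
    where
    open +-*-Solver
    reorder : ∀ t e m → t ℕ.+ (m ℕ.+ suc e) ≡ suc (t ℕ.+ e) ℕ.+ m
    reorder = solve 3 (λ t e m → t :+ (m :+ (con 1 :+ e)) := (con 1 :+ (t :+ e)) :+ m) ≡.refl

  mirror-lower : ∀ j r m → suc j ℕ.+ r ≡ t → suc j ℕ.+ m ≡ t ℕ.+ t → m ≡ t ℕ.+ r
  mirror-lower j r m j+1+r≡t eq =
    ℕₚ.+-cancelˡ-≡ (suc j) _ _ (≡.trans eq (≡.trans (≡.cong (ℕ._+ t) (≡.sym j+1+r≡t)) (reorder (suc j) r t)))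
    where
    open +-*-Solver
    reorder : ∀ a r t → (a ℕ.+ r) ℕ.+ t ≡ a ℕ.+ (t ℕ.+ r)
    reorder = solve 3 (λ a r t → (a :+ r) :+ t := a :+ (t :+ r)) ≡.refl

  module _ (x q b : Carrier) (P U : ℕ → Carrier)
    (xq≈x+b : x * q ≈ x + b)
    (P₁≈P₀ : P 1 ≈ P 0)
    (P-even : ∀ r → P (r ℕ.+ r) ≈ P (suc (suc (r ℕ.+ r))) + b * P (suc (r ℕ.+ r)))
    (P-odd : ∀ r → P (suc (suc (suc (r ℕ.+ r)))) ≈ P (suc (r ℕ.+ r)) + b * P (suc (suc (r ℕ.+ r))))
    (U-rec : ∀ i → i < k → U i ≈ x * (1# + ∑ k (λ j → (if linked k i j then q else 1#) * U j)))
    where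

    N : Carrier
    N = P (suc k)

    -- β i = P (2(t - i)) for i ≤ t and β i = P (2(i - t) + 1) for i ≥ t; at i = t these agree by P₁≈P₀.
    β-from : ℕ → ℕ → Carrier
    β-from zero    e = P (suc (e ℕ.+ e))
    β-from (suc d) _ = P (suc d ℕ.+ suc d)

    β : ℕ → Carrier
    β i = β-from (t ∸ i) (i ∸ t)

    β-upper : ∀ e → β (t ℕ.+ e) ≈ P (suc (e ℕ.+ e))
    β-upper e = reflexive (≡.cong₂ β-from (ℕₚ.m≤n⇒m∸n≡0 (ℕₚ.m≤m+n t e)) (ℕₚ.m+n∸m≡n t e))

    β-lower : ∀ i r → i ℕ.+ r ≡ t → β i ≈ P (r ℕ.+ r)
    β-lower i r ≡.refl = begin
      β-from (i ℕ.+ r ∸ i) (i ∸ (i ℕ.+ r))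
        ≡⟨ ≡.cong₂ β-from (ℕₚ.m+n∸m≡n i r) (ℕₚ.m≤n⇒m∸n≡0 (ℕₚ.m≤m+n i r)) ⟩
      β-from r 0
        ≈⟨ β-from-zero r ⟩
      P (r ℕ.+ r) ∎
      where
      β-from-zero : ∀ r → β-from r 0 ≈ P (r ℕ.+ r)
      β-from-zero zero    = P₁≈P₀
      β-from-zero (suc r) = refl

    β-step-upper : ∀ e m → m ℕ.+ suc e ≡ t → β (suc (t ℕ.+ e)) ≈ β (t ℕ.+ e) + b * β m
    β-step-upper e m m+e+1≡t = begin
      β (suc (t ℕ.+ e))
        ≡⟨ ≡.cong β (ℕₚ.+-suc t e) ⟨
      β (t ℕ.+ suc e)
        ≈⟨ β-upper (suc e) ⟩
      P (suc (suc e ℕ.+ suc e))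
        ≡⟨ ≡.cong (λ n → P (suc (suc n))) (ℕₚ.+-suc e e) ⟩
      P (suc (suc (suc (e ℕ.+ e))))
        ≈⟨ P-odd e ⟩
      P (suc (e ℕ.+ e)) + b * P (suc (suc (e ℕ.+ e)))
        ≡⟨ ≡.cong (λ n → P (suc (e ℕ.+ e)) + b * P (suc n)) (ℕₚ.+-suc e e) ⟨
      P (suc (e ℕ.+ e)) + b * P (suc e ℕ.+ suc e)
        ≈⟨ +-cong (β-upper e) (*-congˡ (β-lower m (suc e) m+e+1≡t)) ⟨
      β (t ℕ.+ e) + b * β m ∎

    β-step-lower : ∀ j r → suc j ℕ.+ r ≡ t → β (suc j) ≈ β j + b * β (t ℕ.+ r)
    β-step-lower j r j+1+r≡t = begin
      β (suc j)
        ≈⟨ β-lower (suc j) r j+1+r≡t ⟩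
      P (r ℕ.+ r)
        ≈⟨ P-even r ⟩
      P (suc (suc (r ℕ.+ r))) + b * P (suc (r ℕ.+ r))
        ≡⟨ ≡.cong (λ n → P (suc n) + b * P (suc (r ℕ.+ r))) (ℕₚ.+-suc r r) ⟨
      P (suc r ℕ.+ suc r) + b * P (suc (r ℕ.+ r))
        ≈⟨ +-cong (β-lower j (suc r) (≡.trans (ℕₚ.+-suc j r) j+1+r≡t)) (*-congˡ (β-upper r)) ⟨
      β j + b * β (t ℕ.+ r) ∎

    β-step : ∀ j m → suc j ℕ.+ m ≡ t ℕ.+ t → β (suc j) ≈ β j + b * β m
    β-step j m eq with ℕₚ.≤-<-connex t j
    ... | inj₁ t≤j with e , ≡.refl ← ℕₚ.m≤n⇒∃[o]m+o≡n t≤j = β-step-upper e m (mirror-upper e m eq)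
    ... | inj₂ j<t with r , j+1+r≡t ← ℕₚ.m≤n⇒∃[o]m+o≡n j<t
                   with ≡.refl ← mirror-lower j r m j+1+r≡t eq = β-step-lower j r j+1+r≡t

    β-window : ∀ j m → j ℕ.+ m ≡ t ℕ.+ t → β j ≈ N + b * ∑ (suc j) (λ e → β (m ℕ.+ e))
    β-window zero m ≡.refl = begin
      β 0                                       ≈⟨ β-lower 0 t ≡.refl ⟩
      P (t ℕ.+ t)                               ≈⟨ P-even t ⟩
      N + b * P (suc (t ℕ.+ t))                 ≈⟨ +-congˡ (*-congˡ (β-upper t)) ⟨
      N + b * β (t ℕ.+ t)                       ≡⟨ ≡.cong (λ n → N + b * β n) (ℕₚ.+-identityʳ (t ℕ.+ t)) ⟨
      N + b * β ((t ℕ.+ t) ℕ.+ 0)               ≈⟨ +-congˡ (*-congˡ (+-identityˡ _)) ⟨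
      N + b * ∑ 1 (λ e → β ((t ℕ.+ t) ℕ.+ e))  ∎
    β-window (suc j) m eq = begin
      β (suc j)
        ≈⟨ β-step j m eq ⟩
      β j + b * β m
        ≈⟨ +-congʳ (β-window j (suc m) (≡.trans (ℕₚ.+-suc j m) eq)) ⟩
      (N + b * ∑ (suc j) (λ e → β (suc m ℕ.+ e))) + b * β m
        ≈⟨ trans (+-assoc _ _ _) (+-congˡ (trans (sym (distribˡ b _ (β m))) (*-congˡ (+-comm _ (β m))))) ⟩
      N + b * (β m + ∑ (suc j) (λ e → β (suc m ℕ.+ e)))
        ≈⟨ +-congˡ (*-congˡ window-head) ⟨
      N + b * ∑ (suc (suc j)) (λ e → β (m ℕ.+ e)) ∎
      where
      window-head : ∑ (suc (suc j)) (λ e → β (m ℕ.+ e)) ≈ β m + ∑ (suc j) (λ e → β (suc m ℕ.+ e))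
      window-head = trans (∑-head (suc j) _) (+-cong (reflexive (≡.cong β (ℕₚ.+-identityʳ m)))
                                                     (∑-cong (suc j) (λ e → reflexive (≡.cong β (ℕₚ.+-suc m e)))))

    linkedβ : ℕ → Carrier
    linkedβ j = ∑ k (λ i → if linked k i j then β i else 0#)

    linkedβ-window : ∀ j m → j ℕ.+ m ≡ t ℕ.+ t → linkedβ j ≈ ∑ (suc j) (λ e → β (m ℕ.+ e))
    linkedβ-window j m eq = begin
      ∑ k F                          ≡⟨ ≡.cong (λ n → ∑ n F) k≡m+j+1 ⟩
      ∑ (m ℕ.+ suc j) F              ≈⟨ ∑-suffix m (suc j) F (λ i i<m → reflexive (F-unlinked i<m)) ⟩
      ∑ (suc j) (λ e → F (m ℕ.+ e))  ≈⟨ ∑-cong (suc j) (λ e → reflexive (F-linked e)) ⟩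
      ∑ (suc j) (λ e → β (m ℕ.+ e))  ∎
      where
      F : ℕ → Carrier
      F i = if linked k i j then β i else 0#
      m+j≡2t : m ℕ.+ j ≡ t ℕ.+ t
      m+j≡2t = ≡.trans (ℕₚ.+-comm m j) eq
      k≡m+j+1 : k ≡ m ℕ.+ suc j
      k≡m+j+1 = ≡.trans (≡.cong suc (≡.sym m+j≡2t)) (≡.sym (ℕₚ.+-suc m j))
      F-unlinked : ∀ {i} → i < m → F i ≡ 0#
      F-unlinked {i} i<m = ≡.cong (λ l → if l then β i else 0#)
        (linked-false i j (ℕₚ.<-≤-trans (ℕₚ.+-monoˡ-< j i<m) (ℕₚ.≤-reflexive m+j≡2t)))
      F-linked : ∀ e → F (m ℕ.+ e) ≡ β (m ℕ.+ e)
      F-linked e = ≡.cong (λ l → if l then β (m ℕ.+ e) else 0#) (linked-true (m ℕ.+ e) j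
        (ℕₚ.≤-trans (ℕₚ.≤-reflexive (≡.sym m+j≡2t)) (ℕₚ.+-monoˡ-≤ j (ℕₚ.m≤m+n m e))))

    β-eigen : ∀ j → j < k → β j ≈ N + b * linkedβ j
    β-eigen j j<k = trans (β-window j m j+m≡2t) (+-congˡ (*-congˡ (sym (linkedβ-window j m j+m≡2t))))
      where
      m = (t ℕ.+ t) ∸ j
      j+m≡2t : j ℕ.+ m ≡ t ℕ.+ t
      j+m≡2t = ℕₚ.m+[n∸m]≡n (ℕₚ.≤-pred j<k)

    ∑β : ∑ k β ≈ ∑ k (λ j → P (suc j))
    ∑β = begin
      ∑ k β
        ≡⟨ ≡.cong (λ n → ∑ n β) (ℕₚ.+-suc t t) ⟨
      ∑ (t ℕ.+ suc t) β
        ≈⟨ ∑-split t (suc t) β ⟩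
      ∑ t β + ∑ (suc t) (λ e → β (t ℕ.+ e))
        ≈⟨ +-cong lower-half (∑-cong (suc t) β-upper) ⟩
      ∑ t (λ r → P (suc (suc (r ℕ.+ r)))) + ∑ (suc t) (λ e → P (suc (e ℕ.+ e)))
        ≈⟨ +-comm _ _ ⟩
      ∑ (suc t) (λ e → P (suc (e ℕ.+ e))) + ∑ t (λ r → P (suc (suc (r ℕ.+ r))))
        ≈⟨ ∑-even-odd t (λ j → P (suc j)) ⟨
      ∑ k (λ j → P (suc j)) ∎
      where
      lower-half : ∑ t β ≈ ∑ t (λ r → P (suc (suc (r ℕ.+ r))))
      lower-half = trans (∑-reverse t β) (∑-cong< t (λ r r<t → trans (β-lower (t ∸ suc r) (suc r) (ℕₚ.m∸n+n≡m r<t))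
                                                                    (reflexive (≡.cong (λ n → P (suc n)) (ℕₚ.+-suc r r)))))

    T G : Carrier
    T = ∑ k U
    G = 1# + T

    linkedU : ℕ → Carrier
    linkedU i = ∑ k (λ j → if linked k i j then U j else 0#)

    x*weighted : ∀ l V → x * ((if l then q else 1#) * V) ≈ x * V + b * (if l then V else 0#)
    x*weighted true  V = begin
      x * (q * V)     ≈⟨ *-assoc x q V ⟨
      (x * q) * V     ≈⟨ *-congʳ xq≈x+b ⟩
      (x + b) * V     ≈⟨ distribʳ V x b ⟩
      x * V + b * V   ∎
    x*weighted false V = begin
      x * (1# * V)    ≈⟨ *-congˡ (*-identityˡ V) ⟩
      x * V           ≈⟨ +-identityʳ _ ⟨
      x * V + 0#      ≈⟨ +-congˡ (zeroʳ b) ⟨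
      x * V + b * 0#  ∎

    U-split : ∀ i → i < k → U i ≈ x * G + b * linkedU i
    U-split i i<k = begin
      U i
        ≈⟨ U-rec i i<k ⟩
      x * (1# + ∑ k (λ j → w j * U j))
        ≈⟨ distribˡ x 1# _ ⟩
      x * 1# + x * ∑ k (λ j → w j * U j)
        ≈⟨ +-congˡ (trans (*-distribˡ-∑ k x _) (∑-cong k (λ j → x*weighted (linked k i j) (U j)))) ⟩
      x * 1# + ∑ k (λ j → x * U j + b * Uᵢ j)
        ≈⟨ +-congˡ (trans (∑-distrib-+ k _ _) (sym (+-cong (*-distribˡ-∑ k x U) (*-distribˡ-∑ k b Uᵢ)))) ⟩
      x * 1# + (x * T + b * linkedU i)
        ≈⟨ +-assoc _ _ _ ⟨
      (x * 1# + x * T) + b * linkedU i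
        ≈⟨ +-congʳ (distribˡ x 1# T) ⟨
      x * G + b * linkedU i ∎
      where
      w Uᵢ : ℕ → Carrier
      w j = if linked k i j then q else 1#
      Uᵢ j = if linked k i j then U j else 0#

    pairing : ∑ k (λ i → β i * U i) ≈ (x * G) * ∑ k β + b * ∑ k (λ j → U j * linkedβ j)
    pairing = begin
      ∑ k (λ i → β i * U i)
        ≈⟨ ∑-cong< k (λ i i<k → *-congˡ (U-split i i<k)) ⟩
      ∑ k (λ i → β i * (x * G + b * linkedU i))
        ≈⟨ ∑-cong k (λ i → trans (distribˡ (β i) _ _)
                                 (+-cong (*-comm (β i) (x * G)) (x∙yz≈y∙xz (β i) b (linkedU i)))) ⟩
      ∑ k (λ i → (x * G) * β i + b * (β i * linkedU i))
        ≈⟨ trans (∑-distrib-+ k _ _) (sym (+-cong (*-distribˡ-∑ k (x * G) β) (*-distribˡ-∑ k b _))) ⟩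
      (x * G) * ∑ k β + b * ∑ k (λ i → β i * linkedU i)
        ≈⟨ +-congˡ (*-congˡ transpose) ⟩
      (x * G) * ∑ k β + b * ∑ k (λ j → U j * linkedβ j) ∎
      where
      swap : ∀ l y u → y * (if l then u else 0#) ≈ u * (if l then y else 0#)
      swap true  y u = *-comm y u
      swap false y u = trans (zeroʳ y) (sym (zeroʳ u))
      transpose : ∑ k (λ i → β i * linkedU i) ≈ ∑ k (λ j → U j * linkedβ j)
      transpose = begin
        ∑ k (λ i → β i * linkedU i)
          ≈⟨ ∑-cong k (λ i → *-distribˡ-∑ k (β i) _) ⟩
        ∑ k (λ i → ∑ k (λ j → β i * (if linked k i j then U j else 0#)))
          ≈⟨ ∑-cong k (λ i → ∑-cong k (λ j → swap (linked k i j) (β i) (U j))) ⟩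
        ∑ k (λ i → ∑ k (λ j → U j * (if linked k i j then β i else 0#)))
          ≈⟨ ∑-comm k k _ ⟩
        ∑ k (λ j → ∑ k (λ i → U j * (if linked k i j then β i else 0#)))
          ≈⟨ ∑-cong k (λ j → *-distribˡ-∑ k (U j) _) ⟨
        ∑ k (λ j → U j * linkedβ j) ∎

    eigen-pairing : ∑ k (λ j → U j * β j) ≈ T * N + b * ∑ k (λ j → U j * linkedβ j)
    eigen-pairing = begin
      ∑ k (λ j → U j * β j)
        ≈⟨ ∑-cong< k (λ j j<k → *-congˡ (β-eigen j j<k)) ⟩
      ∑ k (λ j → U j * (N + b * linkedβ j))
        ≈⟨ ∑-cong k (λ j → trans (distribˡ (U j) N _) (+-congˡ (x∙yz≈y∙xz (U j) b (linkedβ j)))) ⟩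
      ∑ k (λ j → U j * N + b * (U j * linkedβ j))
        ≈⟨ trans (∑-distrib-+ k _ _) (sym (+-cong (*-distribʳ-∑ k N U) (*-distribˡ-∑ k b _))) ⟩
      T * N + b * ∑ k (λ j → U j * linkedβ j) ∎

    T*N≈xG*∑β : T * N ≈ (x * G) * ∑ k β
    T*N≈xG*∑β = cancelʳ (b * ∑ k (λ j → U j * linkedβ j)) _ _
      (trans (sym eigen-pairing) (trans (∑-cong k (λ j → *-comm (U j) (β j))) pairing))

    transfer-identity : (1# + ∑ k U) * (N - x * ∑ k (λ j → P (suc j))) ≈ N
    transfer-identity = begin
      G * (N - x * ∑ k (λ j → P (suc j)))      ≈⟨ *-congˡ (+-congˡ (-‿cong (*-congˡ (sym ∑β)))) ⟩
      G * (N - x * ∑ k β)                      ≈⟨ distribˡ G N (- (x * ∑ k β)) ⟩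
      G * N + G * - (x * ∑ k β)                ≈⟨ +-congˡ (-‿distribʳ-* G (x * ∑ k β)) ⟨
      G * N - G * (x * ∑ k β)                  ≈⟨ +-congˡ (-‿cong (x∙yz≈yx∙z G x (∑ k β))) ⟩
      G * N - (x * G) * ∑ k β                  ≈⟨ +-congʳ (trans (distribʳ N 1# T) (+-congʳ (*-identityˡ N))) ⟩
      (N + T * N) - (x * G) * ∑ k β            ≈⟨ +-congʳ (+-congˡ T*N≈xG*∑β) ⟩
      (N + (x * G) * ∑ k β) - (x * G) * ∑ k β  ≈⟨ //-rightDividesʳ ((x * G) * ∑ k β) N ⟩
      N                                        ∎

module Coefficients where

  open import Data.Nat as ℕ using (zero; suc; _∸_; _≤_; z≤n; s≤s; _/_; ⌊_/2⌋)
  import Data.Nat.Properties as ℕₚ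
  open import Data.Nat.DivMod using (m/n≡1+[m∸n]/n)
  open import Data.Nat.Combinatorics using (_C_; nCk+nC[k+1]≡[n+1]C[k+1]; k>n⇒nCk≡0)
  open import Data.Integer as ℤ using (ℤ; +_; -_; _*_)
  import Data.Integer.Properties as ℤₚ
  open import Relation.Binary.PropositionalEquality
  open ≡-Reasoning

  ⌊n/2⌋≡n/2 : ∀ n → ⌊ n /2⌋ ≡ n / 2
  ⌊n/2⌋≡n/2 zero          = refl
  ⌊n/2⌋≡n/2 (suc zero)    = refl
  ⌊n/2⌋≡n/2 (suc (suc n)) =
    trans (cong suc (⌊n/2⌋≡n/2 n)) (sym (m/n≡1+[m∸n]/n {suc (suc n)} {2} (s≤s (s≤s z≤n))))

  sgn-+ : ∀ a b → sgn (a ℕ.+ b) ≡ sgn a * sgn b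
  sgn-+ zero    b = sym (ℤₚ.*-identityˡ (sgn b))
  sgn-+ (suc a) b = trans (cong -_ (sgn-+ a b)) (ℤₚ.neg-distribˡ-* (sgn a) (sgn b))

  neg*neg : ∀ a b → (- a) * (- b) ≡ a * b
  neg*neg a b = begin
    (- a) * (- b)  ≡⟨ ℤₚ.neg-distribˡ-* a (- b) ⟨
    - (a * (- b))  ≡⟨ cong -_ (ℤₚ.neg-distribʳ-* a b) ⟨
    - - (a * b)    ≡⟨ ℤₚ.neg-involutive (a * b) ⟩
    a * b          ∎

  sgn*sgn : ∀ a → sgn a * sgn a ≡ + 1
  sgn*sgn zero    = refl
  sgn*sgn (suc a) = trans (neg*neg (sgn a) (sgn a)) (sgn*sgn a)

  sgn⌊2+m/2⌋ : ∀ m → sgn ⌊ suc (suc m) /2⌋ ≡ sgn (suc m) * sgn ⌊ suc m /2⌋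
  sgn⌊2+m/2⌋ zero          = refl
  sgn⌊2+m/2⌋ (suc zero)    = refl
  sgn⌊2+m/2⌋ (suc (suc m)) = begin
    - sgn ⌊ suc (suc m) /2⌋
      ≡⟨ cong -_ (sgn⌊2+m/2⌋ m) ⟩
    - (sgn (suc m) * sgn ⌊ suc m /2⌋)
      ≡⟨ ℤₚ.neg-distribʳ-* (sgn (suc m)) _ ⟩
    sgn (suc m) * - sgn ⌊ suc m /2⌋
      ≡⟨ cong (_* - sgn ⌊ suc m /2⌋) (ℤₚ.neg-involutive (sgn (suc m))) ⟨
    sgn (suc (suc (suc m))) * sgn ⌊ suc (suc (suc m)) /2⌋ ∎

  -- coeff n i is the coefficient of b^i in P_n, where P_0 = P_1 = 1 and P_{n+2} = P_n + (-1)^{n+1} b P_{n+1}.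
  coeff : ℕ → ℕ → ℤ
  coeff zero          zero    = + 1
  coeff zero          (suc i) = + 0
  coeff (suc zero)    zero    = + 1
  coeff (suc zero)    (suc i) = + 0
  coeff (suc (suc n)) zero    = coeff n zero
  coeff (suc (suc n)) (suc i) = coeff n (suc i) ℤ.+ sgn (suc n) * coeff (suc n) i

  coeff-zero : ∀ n → coeff n 0 ≡ + 1
  coeff-zero zero          = refl
  coeff-zero (suc zero)    = refl
  coeff-zero (suc (suc n)) = coeff-zero n

  coeff-degree : ∀ n i → n ≤ i → coeff (suc n) (suc i) ≡ + 0
  coeff-above : ∀ n i → n ≤ i → coeff n (suc i) ≡ + 0
  coeff-degree zero    i       _         = refl
  coeff-degree (suc n) (suc i) (s≤s n≤i) = begin
    coeff n (suc (suc i)) ℤ.+ sgn (suc n) * coeff (suc n) (suc i)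
      ≡⟨ cong₂ (λ a c → a ℤ.+ sgn (suc n) * c)
               (coeff-above n (suc i) (ℕₚ.m≤n⇒m≤1+n n≤i)) (coeff-degree n i n≤i) ⟩
    + 0 ℤ.+ sgn (suc n) * + 0
      ≡⟨ trans (ℤₚ.+-identityˡ _) (ℤₚ.*-zeroʳ (sgn (suc n))) ⟩
    + 0 ∎
  coeff-above zero    i       _         = refl
  coeff-above (suc n) (suc i) (s≤s n≤i) = coeff-degree n (suc i) (ℕₚ.m≤n⇒m≤1+n n≤i)

  sign : ℕ → ℕ → ℤ
  sign i d = sgn ⌊ suc (i ℕ.+ d) /2⌋ * sgn ⌊ suc d /2⌋

  sign-suc : ∀ i d → sign (suc i) d ≡ sgn (suc (i ℕ.+ d)) * sign i d
  sign-suc i d = trans (cong (_* sgn ⌊ suc d /2⌋) (sgn⌊2+m/2⌋ (i ℕ.+ d))) (ℤₚ.*-assoc (sgn (suc (i ℕ.+ d))) _ _)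

  sign-shift : ∀ i d → sign i (suc (suc d)) ≡ sign i d
  sign-shift i d = begin
    sgn ⌊ suc (i ℕ.+ suc (suc d)) /2⌋ * sgn ⌊ suc (suc (suc d)) /2⌋
      ≡⟨ cong (λ n → sgn ⌊ suc n /2⌋ * sgn ⌊ suc (suc (suc d)) /2⌋)
              (trans (ℕₚ.+-suc i (suc d)) (cong suc (ℕₚ.+-suc i d))) ⟩
    (- sgn ⌊ suc (i ℕ.+ d) /2⌋) * (- sgn ⌊ suc d /2⌋)
      ≡⟨ neg*neg (sgn ⌊ suc (i ℕ.+ d) /2⌋) (sgn ⌊ suc d /2⌋) ⟩
    sign i d ∎

  coeff-closed : ∀ i d → coeff (suc (i ℕ.+ d)) i ≡ sign i d * + ((⌊ d /2⌋ ℕ.+ i) C i)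
  coeff-closed-lower : ∀ i d → coeff (i ℕ.+ d) (suc i) ≡ sign (suc i) d * + ((⌊ d /2⌋ ℕ.+ i) C suc i)

  coeff-closed zero    d = trans (coeff-zero (suc d)) (sym (trans (ℤₚ.*-identityʳ (sign 0 d)) (sgn*sgn ⌊ suc d /2⌋)))
  coeff-closed (suc i) d = begin
    coeff (i ℕ.+ d) (suc i) ℤ.+ sgn (suc (i ℕ.+ d)) * coeff (suc (i ℕ.+ d)) i
      ≡⟨ cong₂ (λ a c → a ℤ.+ sgn (suc (i ℕ.+ d)) * c) (coeff-closed-lower i d) (coeff-closed i d) ⟩
    s * + (n C suc i) ℤ.+ sgn (suc (i ℕ.+ d)) * (sign i d * + (n C i))
      ≡⟨ cong (λ c → s * + (n C suc i) ℤ.+ c) (ℤₚ.*-assoc (sgn (suc (i ℕ.+ d))) (sign i d) (+ (n C i))) ⟨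
    s * + (n C suc i) ℤ.+ sgn (suc (i ℕ.+ d)) * sign i d * + (n C i)
      ≡⟨ cong (λ c → s * + (n C suc i) ℤ.+ c * + (n C i)) (sign-suc i d) ⟨
    s * + (n C suc i) ℤ.+ s * + (n C i)
      ≡⟨ ℤₚ.*-distribˡ-+ s _ _ ⟨
    s * (+ (n C suc i) ℤ.+ + (n C i))
      ≡⟨ cong (s *_) (ℤₚ.pos-+ (n C suc i) (n C i)) ⟨
    s * + (n C suc i ℕ.+ n C i)
      ≡⟨ cong (λ c → s * + c) (trans (ℕₚ.+-comm (n C suc i) (n C i)) (nCk+nC[k+1]≡[n+1]C[k+1] n i)) ⟩
    s * + (suc n C suc i)
      ≡⟨ cong (λ m → s * + (m C suc i)) (ℕₚ.+-suc ⌊ d /2⌋ i) ⟨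
    s * + ((⌊ d /2⌋ ℕ.+ suc i) C suc i) ∎
    where
    n = ⌊ d /2⌋ ℕ.+ i
    s = sign (suc i) d

  coeff-closed-lower i zero = begin
    coeff (i ℕ.+ 0) (suc i)         ≡⟨ coeff-above (i ℕ.+ 0) i (ℕₚ.≤-reflexive (ℕₚ.+-identityʳ i)) ⟩
    + 0                             ≡⟨ ℤₚ.*-zeroʳ (sign (suc i) 0) ⟨
    sign (suc i) 0 * + 0            ≡⟨ cong (λ c → sign (suc i) 0 * + c) (k>n⇒nCk≡0 (ℕₚ.n<1+n i)) ⟨
    sign (suc i) 0 * + (i C suc i)  ∎
  coeff-closed-lower i (suc zero) = begin
    coeff (i ℕ.+ 1) (suc i)         ≡⟨ cong (λ n → coeff n (suc i)) (ℕₚ.+-comm i 1) ⟩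
    coeff (suc i) (suc i)           ≡⟨ coeff-degree i i ℕₚ.≤-refl ⟩
    + 0                             ≡⟨ ℤₚ.*-zeroʳ (sign (suc i) 1) ⟨
    sign (suc i) 1 * + 0            ≡⟨ cong (λ c → sign (suc i) 1 * + c) (k>n⇒nCk≡0 (ℕₚ.n<1+n i)) ⟨
    sign (suc i) 1 * + (i C suc i)  ∎
  coeff-closed-lower i (suc (suc d)) = begin
    coeff (i ℕ.+ suc (suc d)) (suc i)
      ≡⟨ cong (λ n → coeff n (suc i)) (trans (ℕₚ.+-suc i (suc d)) (cong suc (ℕₚ.+-suc i d))) ⟩
    coeff (suc (suc i ℕ.+ d)) (suc i)
      ≡⟨ coeff-closed (suc i) d ⟩
    sign (suc i) d * + ((⌊ d /2⌋ ℕ.+ suc i) C suc i)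
      ≡⟨ cong₂ (λ s n → s * + (n C suc i)) (sym (sign-shift (suc i) d)) (ℕₚ.+-suc ⌊ d /2⌋ i) ⟩
    sign (suc i) (suc (suc d)) * + (suc (⌊ d /2⌋ ℕ.+ i) C suc i) ∎

  sgn[1+n]/2 : ∀ n → sgn ((n ℕ.+ 1) / 2) ≡ sgn ⌊ suc n /2⌋
  sgn[1+n]/2 n = cong sgn (trans (sym (⌊n/2⌋≡n/2 (n ℕ.+ 1))) (cong ⌊_/2⌋ (ℕₚ.+-comm n 1)))

  ⌈/2⌉-+-odd : ∀ i d t → i ℕ.+ d ≡ suc (t ℕ.+ t) → ⌊ suc i /2⌋ ℕ.+ ⌊ suc d /2⌋ ≡ suc t
  ⌈/2⌉-+-odd zero          d t       refl = cong suc (sym (ℕₚ.n≡⌊n+n/2⌋ t))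
  ⌈/2⌉-+-odd (suc zero)    d t       eq   =
    cong suc (trans (cong (λ n → ⌊ suc n /2⌋) (ℕₚ.suc-injective eq)) (sym (ℕₚ.n≡⌈n+n/2⌉ t)))
  ⌈/2⌉-+-odd (suc (suc i)) d (suc t) eq   =
    cong suc (⌈/2⌉-+-odd i d t (trans (ℕₚ.suc-injective (ℕₚ.suc-injective eq)) (ℕₚ.+-suc t t)))

  sign-odd : ∀ i d t → i ℕ.+ d ≡ suc (t ℕ.+ t) → sign i d ≡ sgn ⌊ suc i /2⌋
  sign-odd i d t eq = begin
    sgn ⌊ suc (i ℕ.+ d) /2⌋ * s            ≡⟨ cong (λ n → sgn ⌊ suc n /2⌋ * s) eq ⟩
    sgn (suc ⌊ t ℕ.+ t /2⌋) * s            ≡⟨ cong (λ n → sgn (suc n) * s) (ℕₚ.n≡⌊n+n/2⌋ t) ⟨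
    sgn (suc t) * s                        ≡⟨ cong (λ n → sgn n * s) (⌈/2⌉-+-odd i d t eq) ⟨
    sgn (⌊ suc i /2⌋ ℕ.+ ⌊ suc d /2⌋) * s  ≡⟨ cong (_* s) (sgn-+ ⌊ suc i /2⌋ ⌊ suc d /2⌋) ⟩
    sgn ⌊ suc i /2⌋ * s * s                ≡⟨ ℤₚ.*-assoc (sgn ⌊ suc i /2⌋) s s ⟩
    sgn ⌊ suc i /2⌋ * (s * s)              ≡⟨ cong (sgn ⌊ suc i /2⌋ *_) (sgn*sgn ⌊ suc d /2⌋) ⟩
    sgn ⌊ suc i /2⌋ * + 1                  ≡⟨ ℤₚ.*-identityʳ _ ⟩
    sgn ⌊ suc i /2⌋                        ∎
    where
    s = sgn ⌊ suc d /2⌋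

  Num-coeff : ∀ t i → i ≤ suc (t ℕ.+ t) →
              sgn ((i ℕ.+ 1) / 2) * + (((suc (t ℕ.+ t) ∸ i) / 2 ℕ.+ i) C i) ≡ coeff (suc (suc (t ℕ.+ t))) i
  Num-coeff t i i≤k = begin
    sgn ((i ℕ.+ 1) / 2) * + (((k ∸ i) / 2 ℕ.+ i) C i)
      ≡⟨ cong₂ (λ s n → s * + ((n ℕ.+ i) C i)) (sgn[1+n]/2 i) (sym (⌊n/2⌋≡n/2 (k ∸ i))) ⟩
    sgn ⌊ suc i /2⌋ * + ((⌊ k ∸ i /2⌋ ℕ.+ i) C i)
      ≡⟨ cong (_* + ((⌊ k ∸ i /2⌋ ℕ.+ i) C i)) (sign-odd i (k ∸ i) t i+[k∸i]≡k) ⟨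
    sign i (k ∸ i) * + ((⌊ k ∸ i /2⌋ ℕ.+ i) C i)
      ≡⟨ coeff-closed i (k ∸ i) ⟨
    coeff (suc (i ℕ.+ (k ∸ i))) i
      ≡⟨ cong (λ n → coeff (suc n) i) i+[k∸i]≡k ⟩
    coeff (suc k) i ∎
    where
    k = suc (t ℕ.+ t)
    i+[k∸i]≡k : i ℕ.+ (k ∸ i) ≡ k
    i+[k∸i]≡k = ℕₚ.m+[n∸m]≡n i≤k

  inner-coeff : ∀ j i → i ≤ j →
                sgn ((j ℕ.+ 1) / 2) * (sgn ((j ∸ i ℕ.+ 1) / 2) * + (((j ∸ i) / 2 ℕ.+ i) C i)) ≡ coeff (suc j) i
  inner-coeff j i i≤j = begin
    sgn ((j ℕ.+ 1) / 2) * (sgn ((d ℕ.+ 1) / 2) * + ((d / 2 ℕ.+ i) C i))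
      ≡⟨ cong₂ (λ s n → s * (sgn ((d ℕ.+ 1) / 2) * + ((n ℕ.+ i) C i))) (sgn[1+n]/2 j) (sym (⌊n/2⌋≡n/2 d)) ⟩
    sgn ⌊ suc j /2⌋ * (sgn ((d ℕ.+ 1) / 2) * + ((⌊ d /2⌋ ℕ.+ i) C i))
      ≡⟨ cong (λ s → sgn ⌊ suc j /2⌋ * (s * + ((⌊ d /2⌋ ℕ.+ i) C i))) (sgn[1+n]/2 d) ⟩
    sgn ⌊ suc j /2⌋ * (sgn ⌊ suc d /2⌋ * + ((⌊ d /2⌋ ℕ.+ i) C i))
      ≡⟨ ℤₚ.*-assoc (sgn ⌊ suc j /2⌋) _ _ ⟨
    sgn ⌊ suc j /2⌋ * sgn ⌊ suc d /2⌋ * + ((⌊ d /2⌋ ℕ.+ i) C i)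
      ≡⟨ cong (λ n → sgn ⌊ suc n /2⌋ * sgn ⌊ suc d /2⌋ * + ((⌊ d /2⌋ ℕ.+ i) C i)) i+d≡j ⟨
    sign i d * + ((⌊ d /2⌋ ℕ.+ i) C i)
      ≡⟨ coeff-closed i d ⟨
    coeff (suc (i ℕ.+ d)) i
      ≡⟨ cong (λ n → coeff (suc n) i) i+d≡j ⟩
    coeff (suc j) i ∎
    where
    d = j ∸ i
    i+d≡j : i ℕ.+ d ≡ j
    i+d≡j = ℕₚ.m+[n∸m]≡n i≤j

module Bivariate where

  open import Data.Nat as ℕ using (zero; suc; _∸_)
  open import Data.Integer as ℤ using (ℤ; +_)
  import Data.Integer.Properties as ℤₚ
  open import Relation.Binary.PropositionalEquality as ≡ using (_≡_)

  -- Series is definitionally the carrier of ℤ⟦q⟧⟦x⟧, the coefficient of x^n being the q-series f n.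
  module ℤ⟦q⟧ = PowerSeries ℤₚ.+-*-commutativeRing
  module ℤ⟦q⟧⟦x⟧ = PowerSeries ℤ⟦q⟧.commutativeRing

  open CommutativeRing ℤ⟦q⟧⟦x⟧.commutativeRing
  open Summation ℤ⟦q⟧⟦x⟧.commutativeRing
  open import Relation.Binary.Reasoning.Setoid setoid
  open import Algebra.Definitions.RawSemiring (Semiring.rawSemiring semiring) using (_^_)
  open import Algebra.Properties.Group +-group using (//-rightDividesˡ)

  coeffwise₂ : {f g : Series} → (∀ n m → f n m ≡ g n m) → f ≈ g
  coeffwise₂ f≡g = ℤ⟦q⟧⟦x⟧.coeffwise (λ n → ℤ⟦q⟧.coeffwise (f≡g n))

  coeff₂ : {f g : Series} → f ≈ g → ∀ n m → f n m ≡ g n m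
  coeff₂ f≈g n = ℤ⟦q⟧.coeff (ℤ⟦q⟧⟦x⟧.coeff f≈g n)

  x q : Series
  x = ℤ⟦q⟧⟦x⟧.Xₛ
  q = ℤ⟦q⟧⟦x⟧.constₛ ℤ⟦q⟧.Xₛ

  const : ℤ → Series
  const z = ℤ⟦q⟧⟦x⟧.constₛ (ℤ⟦q⟧.constₛ z)

  sumℤ-cong : ∀ L {F G : ℕ → ℤ} → (∀ j → F j ≡ G j) → sumℤ L F ≡ sumℤ L G
  sumℤ-cong zero    F≡G = ≡.refl
  sumℤ-cong (suc L) F≡G = ≡.cong₂ ℤ._+_ (sumℤ-cong L F≡G) (F≡G L)

  ∑ℤ≡sumℤ : ∀ L F → Summation.∑ ℤₚ.+-*-commutativeRing L F ≡ sumℤ L F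
  ∑ℤ≡sumℤ zero    F = ≡.refl
  ∑ℤ≡sumℤ (suc L) F = ≡.cong (ℤ._+ F L) (∑ℤ≡sumℤ L F)

  +-coeff : ∀ f g n m → (f + g) n m ≡ f n m ℤ.+ g n m
  +-coeff f g n m = ≡.trans (≡.cong (λ h → h m) (ℤ⟦q⟧⟦x⟧.+ₛ-coeff f g n)) (ℤ⟦q⟧.+ₛ-coeff (f n) (g n) m)

  neg-coeff : ∀ f n m → (- f) n m ≡ ℤ.- f n m
  neg-coeff f n m = ≡.trans (≡.cong (λ h → h m) (ℤ⟦q⟧⟦x⟧.-ₛ-coeff f n)) (ℤ⟦q⟧.-ₛ-coeff (f n) m)

  ∑-coeff : ∀ L (F : ℕ → Series) n m → ∑ L F n m ≡ sumℤ L (λ j → F j n m)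
  ∑-coeff L F n m = ≡.trans (≡.cong (λ h → h m) (ℤ⟦q⟧⟦x⟧.∑ₛ-coeff L F n))
                   (≡.trans (ℤ⟦q⟧.∑ₛ-coeff L (λ j → F j n) m) (∑ℤ≡sumℤ L (λ j → F j n m)))

  *-coeff : ∀ f g n m → (f * g) n m ≡ (f ⊗ g) n m
  *-coeff f g n m =
    ≡.trans (≡.cong (λ h → h m) (ℤ⟦q⟧⟦x⟧.*ₛ-coeff f g n))
    (≡.trans (ℤ⟦q⟧.∑ₛ-coeff (suc n) _ m)
    (≡.trans (∑ℤ≡sumℤ (suc n) _)
             (sumℤ-cong (suc n) (λ a → ≡.trans (ℤ⟦q⟧.*ₛ-coeff (f a) (g (n ∸ a)) m) (∑ℤ≡sumℤ (suc m) _)))))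

  ⊕≈+ : ∀ f g → f ⊕ g ≈ f + g
  ⊕≈+ f g = coeffwise₂ (λ n m → ≡.sym (+-coeff f g n m))

  ⊖≈- : ∀ f g → f ⊖ g ≈ f - g
  ⊖≈- f g = coeffwise₂ λ n m →
    ≡.sym (≡.trans (+-coeff f (- g) n m) (≡.cong (λ z → f n m ℤ.+ z) (neg-coeff g n m)))

  ⊗≈* : ∀ f g → f ⊗ g ≈ f * g
  ⊗≈* f g = coeffwise₂ (λ n m → ≡.sym (*-coeff f g n m))

  sumS≈∑ : ∀ L F → sumS L F ≈ ∑ L F
  sumS≈∑ L F = coeffwise₂ (λ n m → ≡.sym (≡.trans (∑-coeff L F n m) (sumℤ≡sumS L)))
    where
    sumℤ≡sumS : ∀ {n m} L → sumℤ L (λ j → F j n m) ≡ sumS L F n m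
    sumℤ≡sumS         zero    = ≡.refl
    sumℤ≡sumS {n} {m} (suc L) = ≡.cong (ℤ._+ F L n m) (sumℤ≡sumS L)

  one≈1 : one ≈ 1#
  one≈1 = coeffwise₂ one-coeff
    where
    one-coeff : ∀ n m → one n m ≡ 1# n m
    one-coeff zero    zero    = ≡.refl
    one-coeff zero    (suc m) = ≡.refl
    one-coeff (suc n) m       = ≡.refl

  X≈x : X ≈ x
  X≈x = coeffwise₂ X-coeff
    where
    X-coeff : ∀ n m → X n m ≡ x n m
    X-coeff zero          zero    = ≡.refl
    X-coeff zero          (suc m) = ≡.refl
    X-coeff (suc zero)    zero    = ≡.refl
    X-coeff (suc zero)    (suc m) = ≡.refl
    X-coeff (suc (suc n)) m       = ≡.refl

  Q≈q : Q ≈ q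
  Q≈q = coeffwise₂ Q-coeff
    where
    Q-coeff : ∀ n m → Q n m ≡ q n m
    Q-coeff zero    zero          = ≡.refl
    Q-coeff zero    (suc zero)    = ≡.refl
    Q-coeff zero    (suc (suc m)) = ≡.refl
    Q-coeff (suc n) zero          = ≡.refl
    Q-coeff (suc n) (suc m)       = ≡.refl

  ^s≈^ : ∀ f i → f ^s i ≈ f ^ i
  ^s≈^ f zero    = one≈1
  ^s≈^ f (suc i) = trans (⊗≈* f (f ^s i)) (*-congˡ (^s≈^ f i))

  const-*-coeff : ∀ z f n m → (const z * f) n m ≡ z ℤ.* f n m
  const-*-coeff z f n m =
    ≡.trans (ℤ⟦q⟧.coeff (ℤ⟦q⟧⟦x⟧.constₛ-* (ℤ⟦q⟧.constₛ z) f n) m) (ℤ⟦q⟧.constₛ-* z (f n) m)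

  scale≈const* : ∀ z f → scale z f ≈ const z * f
  scale≈const* z f = coeffwise₂ (λ n m → ≡.sym (const-*-coeff z f n m))

  const-+ : ∀ a c → const (a ℤ.+ c) ≈ const a + const c
  const-+ a c = coeffwise₂ (λ n m → ≡.trans (const-+-coeff n m) (≡.sym (+-coeff (const a) (const c) n m)))
    where
    const-+-coeff : ∀ n m → const (a ℤ.+ c) n m ≡ const a n m ℤ.+ const c n m
    const-+-coeff zero    zero    = ≡.refl
    const-+-coeff zero    (suc m) = ≡.refl
    const-+-coeff (suc n) m       = ≡.refl

  const-* : ∀ a c → const (a ℤ.* c) ≈ const a * const c
  const-* a c = coeffwise₂ (λ n m → ≡.sym (≡.trans (const-*-coeff a (const c) n m) (const-*-const n m)))
    where
    const-*-const : ∀ n m → a ℤ.* const c n m ≡ const (a ℤ.* c) n m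
    const-*-const zero    zero    = ≡.refl
    const-*-const zero    (suc m) = ℤₚ.*-zeroʳ a
    const-*-const (suc n) m       = ℤₚ.*-zeroʳ a

  const-0 : const (+ 0) ≈ 0#
  const-0 = coeffwise₂ const-0-coeff
    where
    const-0-coeff : ∀ n m → const (+ 0) n m ≡ + 0
    const-0-coeff zero    zero    = ≡.refl
    const-0-coeff zero    (suc m) = ≡.refl
    const-0-coeff (suc n) m       = ≡.refl

  const-neg1 : const (ℤ.- + 1) ≈ - 1#
  const-neg1 = coeffwise₂ (λ n m → ≡.trans (const-neg1-coeff n m) (≡.sym (neg-coeff 1# n m)))
    where
    const-neg1-coeff : ∀ n m → const (ℤ.- + 1) n m ≡ ℤ.- 1# n m
    const-neg1-coeff zero    zero    = ≡.refl
    const-neg1-coeff zero    (suc m) = ≡.refl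
    const-neg1-coeff (suc n) m       = ≡.refl

  b≈x[q-1] : bS ≈ x * (q - 1#)
  b≈x[q-1] = trans (⊗≈* X (Q ⊖ one)) (*-cong X≈x (trans (⊖≈- Q one) (+-cong Q≈q (-‿cong one≈1))))

  xq≈x+b : x * q ≈ x + bS
  xq≈x+b = begin
    x * q                  ≈⟨ *-congˡ (trans (sym (//-rightDividesˡ 1# q)) (+-comm _ 1#)) ⟩
    x * (1# + (q - 1#))    ≈⟨ distribˡ x 1# (q - 1#) ⟩
    x * 1# + x * (q - 1#)  ≈⟨ +-cong (*-identityʳ x) (sym b≈x[q-1]) ⟩
    x + bS                 ∎

module AlternatingPolynomials where

  open import Data.Nat as ℕ using (zero; suc; _∸_; _<_; _/_)
  import Data.Nat.Properties as ℕₚ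
  open import Data.Nat.Combinatorics using (_C_)
  open import Data.Integer as ℤ using (ℤ; +_)
  import Data.Integer.Properties as ℤₚ
  open import Relation.Binary.PropositionalEquality as ≡ using (_≡_)
  open Bivariate
  open CommutativeRing ℤ⟦q⟧⟦x⟧.commutativeRing
  open Summation ℤ⟦q⟧⟦x⟧.commutativeRing
  open import Relation.Binary.Reasoning.Setoid setoid
  open import Algebra.Definitions.RawSemiring (Semiring.rawSemiring semiring) using (_^_)
  open import Algebra.Properties.Group +-group using (//-rightDividesˡ)
  open import Algebra.Properties.Ring ring using (-1*x≈-x)
  open import Algebra.Properties.CommutativeSemigroup *-commutativeSemigroup using (x∙yz≈y∙xz)
  open Coefficients

  eval : ℕ → (ℕ → ℤ) → Series
  eval L p = ∑ L (λ i → const (p i) * bS ^ i)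

  eval-cong< : ∀ L {p p′ : ℕ → ℤ} → (∀ i → i < L → p i ≡ p′ i) → eval L p ≈ eval L p′
  eval-cong< L p≡p′ = ∑-cong< L (λ i i<L → *-congʳ (reflexive (≡.cong const (p≡p′ i i<L))))

  eval-extend : ∀ L p → p L ≡ + 0 → eval (suc L) p ≈ eval L p
  eval-extend L p pL≡0 = begin
    eval L p + const (p L) * bS ^ L  ≈⟨ +-congˡ (*-congʳ (trans (reflexive (≡.cong const pL≡0)) const-0)) ⟩
    eval L p + 0# * bS ^ L           ≈⟨ +-congˡ (zeroˡ _) ⟩
    eval L p + 0#                    ≈⟨ +-identityʳ _ ⟩
    eval L p                         ∎

  eval-+ : ∀ L p p′ → eval L (λ i → p i ℤ.+ p′ i) ≈ eval L p + eval L p′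
  eval-+ L p p′ =
    trans (∑-cong L (λ i → trans (*-congʳ (const-+ (p i) (p′ i))) (distribʳ _ _ _))) (∑-distrib-+ L _ _)

  eval-* : ∀ L c p → eval L (λ i → c ℤ.* p i) ≈ const c * eval L p
  eval-* L c p =
    trans (∑-cong L (λ i → trans (*-congʳ (const-* c (p i))) (*-assoc _ _ _))) (sym (*-distribˡ-∑ L (const c) _))

  shift : (ℕ → ℤ) → ℕ → ℤ
  shift p zero    = + 0
  shift p (suc i) = p i

  eval-shift : ∀ L p → eval (suc L) (shift p) ≈ bS * eval L p
  eval-shift L p = begin
    eval (suc L) (shift p)
      ≈⟨ ∑-head L _ ⟩
    const (+ 0) * 1# + ∑ L (λ i → const (p i) * (bS * bS ^ i))
      ≈⟨ +-cong (trans (*-congʳ const-0) (zeroˡ _)) (∑-cong L (λ i → x∙yz≈y∙xz _ bS _)) ⟩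
    0# + ∑ L (λ i → bS * (const (p i) * bS ^ i))
      ≈⟨ trans (+-identityˡ _) (sym (*-distribˡ-∑ L bS _)) ⟩
    bS * eval L p ∎

  P : ℕ → Series
  P n = eval (suc n) (coeff n)

  P-rec : ∀ n → P (suc (suc n)) ≈ P n + const (sgn (suc n)) * (bS * P (suc n))
  P-rec n = begin
    eval (3 ℕ.+ n) (coeff (2 ℕ.+ n))
      ≈⟨ eval-cong< (3 ℕ.+ n) (λ i _ → coeff-rec i) ⟩
    eval (3 ℕ.+ n) (λ i → coeff n i ℤ.+ s ℤ.* shift (coeff (suc n)) i)
      ≈⟨ eval-+ (3 ℕ.+ n) _ _ ⟩
    eval (3 ℕ.+ n) (coeff n) + eval (3 ℕ.+ n) (λ i → s ℤ.* shift (coeff (suc n)) i)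
      ≈⟨ +-cong truncate (eval-* (3 ℕ.+ n) s _) ⟩
    P n + const s * eval (3 ℕ.+ n) (shift (coeff (suc n)))
      ≈⟨ +-congˡ (*-congˡ (eval-shift (2 ℕ.+ n) (coeff (suc n)))) ⟩
    P n + const s * (bS * P (suc n)) ∎
    where
    s = sgn (suc n)
    coeff-rec : ∀ i → coeff (suc (suc n)) i ≡ coeff n i ℤ.+ s ℤ.* shift (coeff (suc n)) i
    coeff-rec zero    = ≡.sym (≡.trans (≡.cong (λ z → coeff n 0 ℤ.+ z) (ℤₚ.*-zeroʳ s)) (ℤₚ.+-identityʳ _))
    coeff-rec (suc i) = ≡.refl
    truncate : eval (3 ℕ.+ n) (coeff n) ≈ P n
    truncate = trans (eval-extend (2 ℕ.+ n) (coeff n) (coeff-above n (suc n) (ℕₚ.n≤1+n n)))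
                     (eval-extend (suc n) (coeff n) (coeff-above n n ℕₚ.≤-refl))

  P₁≈P₀ : P 1 ≈ P 0
  P₁≈P₀ = eval-extend 1 (coeff 1) ≡.refl

  sgn-even : ∀ r → sgn (r ℕ.+ r) ≡ + 1
  sgn-even r = ≡.trans (sgn-+ r r) (sgn*sgn r)

  P-odd : ∀ r → P (suc (suc (suc (r ℕ.+ r)))) ≈ P (suc (r ℕ.+ r)) + bS * P (suc (suc (r ℕ.+ r)))
  P-odd r = trans (P-rec (suc (r ℕ.+ r))) (+-congˡ (trans (*-congʳ const-sgn≈1) (*-identityˡ _)))
    where
    const-sgn≈1 : const (sgn (suc (suc (r ℕ.+ r)))) ≈ 1#
    const-sgn≈1 = reflexive (≡.cong const (≡.trans (ℤₚ.neg-involutive _) (sgn-even r)))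

  P-even : ∀ r → P (r ℕ.+ r) ≈ P (suc (suc (r ℕ.+ r))) + bS * P (suc (r ℕ.+ r))
  P-even r = begin
    P (r ℕ.+ r)                  ≈⟨ //-rightDividesˡ y (P (r ℕ.+ r)) ⟨
    (P (r ℕ.+ r) - y) + y        ≈⟨ +-congʳ P₂ᵣ₊₂≈P₂ᵣ-y ⟨
    P (suc (suc (r ℕ.+ r))) + y  ∎
    where
    y = bS * P (suc (r ℕ.+ r))
    const-sgn≈-1 : const (sgn (suc (r ℕ.+ r))) ≈ - 1#
    const-sgn≈-1 = trans (reflexive (≡.cong (λ z → const (ℤ.- z)) (sgn-even r))) const-neg1
    P₂ᵣ₊₂≈P₂ᵣ-y : P (suc (suc (r ℕ.+ r))) ≈ P (r ℕ.+ r) - y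
    P₂ᵣ₊₂≈P₂ᵣ-y = trans (P-rec (r ℕ.+ r)) (+-congˡ (trans (*-congʳ const-sgn≈-1) (-1*x≈-x y)))

  Num≈P : ∀ t → Num (suc (t ℕ.+ t)) ≈ P (suc (suc (t ℕ.+ t)))
  Num≈P t = begin
    Num k                                    ≈⟨ sumS≈∑ (suc k) _ ⟩
    ∑ (suc k) (λ i → scale (c i) (bS ^s i))  ≈⟨ ∑-cong< (suc k) term ⟩
    eval (suc k) (coeff (suc k))             ≈⟨ eval-extend (suc k) (coeff (suc k)) (coeff-degree k k ℕₚ.≤-refl) ⟨
    P (suc k)                                ∎
    where
    k = suc (t ℕ.+ t)
    c : ℕ → ℤ
    c i = sgn ((i ℕ.+ 1) / 2) ℤ.* + (((k ∸ i) / 2 ℕ.+ i) C i)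
    term : ∀ i → i < suc k → scale (c i) (bS ^s i) ≈ const (coeff (suc k) i) * bS ^ i
    term i i≤k = trans (scale≈const* _ _)
                       (*-cong (reflexive (≡.cong const (Num-coeff t i (ℕₚ.≤-pred i≤k)))) (^s≈^ bS i))

  inner≈P : ∀ j → inner j ≈ P (suc j)
  inner≈P j = begin
    inner j
      ≈⟨ trans (⊕≈+ one _) (+-cong one≈1 (trans (scale≈const* s _) (*-congˡ (sumS≈∑ j _)))) ⟩
    1# + const s * ∑ j (λ i → scale (c (suc i)) (bS ^s suc i))
      ≈⟨ +-congˡ (trans (*-distribˡ-∑ j (const s) _) (∑-cong< j term)) ⟩
    1# + ∑ j (λ i → const (coeff (suc j) (suc i)) * bS ^ suc i)
      ≈⟨ +-congʳ (trans (sym (*-identityʳ 1#)) (*-congʳ (reflexive (≡.cong const (≡.sym (coeff-zero (suc j))))))) ⟩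
    const (coeff (suc j) 0) * 1# + ∑ j (λ i → const (coeff (suc j) (suc i)) * bS ^ suc i)
      ≈⟨ ∑-head j _ ⟨
    eval (suc j) (coeff (suc j))
      ≈⟨ eval-extend (suc j) (coeff (suc j)) (coeff-degree j j ℕₚ.≤-refl) ⟨
    P (suc j) ∎
    where
    s = sgn ((j ℕ.+ 1) / 2)
    c : ℕ → ℤ
    c i = sgn ((j ∸ i ℕ.+ 1) / 2) ℤ.* + (((j ∸ i) / 2 ℕ.+ i) C i)
    term : ∀ i → i < j → const s * scale (c (suc i)) (bS ^s suc i) ≈ const (coeff (suc j) (suc i)) * bS ^ suc i
    term i i<j = begin
      const s * scale (c (suc i)) (bS ^s suc i)   ≈⟨ *-congˡ (trans (scale≈const* _ _) (*-congˡ (^s≈^ bS (suc i)))) ⟩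
      const s * (const (c (suc i)) * bS ^ suc i)  ≈⟨ *-assoc _ _ _ ⟨
      (const s * const (c (suc i))) * bS ^ suc i  ≈⟨ *-congʳ (const-* s (c (suc i))) ⟨
      const (s ℤ.* c (suc i)) * bS ^ suc i        ≡⟨ ≡.cong (λ z → const z * bS ^ suc i) (inner-coeff j (suc i) i<j) ⟩
      const (coeff (suc j) (suc i)) * bS ^ suc i  ∎

module WordSeries where

  open import Data.Nat as ℕ using (zero; suc)
  open import Data.Integer as ℤ using (ℤ; +_)
  import Data.Integer.Properties as ℤₚ
  open import Data.Bool using (true; false; if_then_else_)
  open import Relation.Binary.PropositionalEquality as ≡ using (_≡_)
  open WordCounts using (linked; qIf; countFrom; GC-suc)
  open Bivariate
  open CommutativeRing ℤ⟦q⟧⟦x⟧.commutativeRing using (_+_; _*_; 1#; _≈_)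
  open Summation ℤ⟦q⟧⟦x⟧.commutativeRing using (∑)

  wordSeries : ℕ → ℕ → Series
  wordSeries k i zero    m = + 0
  wordSeries k i (suc n) m = countFrom k i n m

  sumℤ-zero : ∀ L {F : ℕ → ℤ} → (∀ j → F j ≡ + 0) → sumℤ L F ≡ + 0
  sumℤ-zero zero    F≡0 = ≡.refl
  sumℤ-zero (suc L) F≡0 = ≡.cong₂ ℤ._+_ (sumℤ-zero L F≡0) (F≡0 L)

  GC≈1+∑ : ∀ k → GC k ≈ 1# + ∑ k (wordSeries k)
  GC≈1+∑ k = coeffwise₂ λ n m →
    ≡.sym (≡.trans (+-coeff 1# _ n m) (≡.trans (≡.cong (λ z → 1# n m ℤ.+ z) (∑-coeff k _ n m)) (by-length n m)))
    where
    by-length : ∀ n m → 1# n m ℤ.+ sumℤ k (λ j → wordSeries k j n m) ≡ GC k n m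
    by-length zero    zero    = ≡.cong (λ z → + 1 ℤ.+ z) (sumℤ-zero k (λ _ → ≡.refl))
    by-length zero    (suc m) = ≡.cong (λ z → + 0 ℤ.+ z) (sumℤ-zero k (λ _ → ≡.refl))
    by-length (suc n) m       = ≡.trans (ℤₚ.+-identityˡ _) (≡.trans (≡.sym (∑ℤ≡sumℤ k _)) (≡.sym (GC-suc k n m)))

  weight-coeff : ∀ l V n m → ((if l then q else 1#) * V) n m ≡ qIf l (V n) m
  weight-coeff true  V n zero    =
    ≡.trans (ℤ⟦q⟧.coeff (ℤ⟦q⟧⟦x⟧.constₛ-* ℤ⟦q⟧.Xₛ V n) 0) (ℤ⟦q⟧.Xₛ-*-zero (V n))
  weight-coeff true  V n (suc m) =
    ≡.trans (ℤ⟦q⟧.coeff (ℤ⟦q⟧⟦x⟧.constₛ-* ℤ⟦q⟧.Xₛ V n) (suc m)) (ℤ⟦q⟧.Xₛ-*-suc (V n) m)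
  weight-coeff false V n m       = ℤ⟦q⟧.coeff (ℤ⟦q⟧⟦x⟧.*ₛ-identityˡ V n) m

  wordSeries-rec : ∀ k i → wordSeries k i ≈ x * (1# + ∑ k (λ j → (if linked k i j then q else 1#) * wordSeries k j))
  wordSeries-rec k i = coeffwise₂ λ where
      zero    m → ≡.sym (ℤ⟦q⟧.coeff (ℤ⟦q⟧⟦x⟧.Xₛ-*-zero F) m)
      (suc n) m → ≡.sym (≡.trans (ℤ⟦q⟧.coeff (ℤ⟦q⟧⟦x⟧.Xₛ-*-suc F n) m) (≡.trans (+-coeff 1# _ n m)
                          (≡.trans (≡.cong (λ z → 1# n m ℤ.+ z) (F-coeff n m)) (first-letter n m))))
    where
    F = 1# + ∑ k (λ j → (if linked k i j then q else 1#) * wordSeries k j)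
    F-coeff : ∀ n m → ∑ k (λ j → (if linked k i j then q else 1#) * wordSeries k j) n m ≡
                      sumℤ k (λ j → qIf (linked k i j) (wordSeries k j n) m)
    F-coeff n m = ≡.trans (∑-coeff k _ n m) (sumℤ-cong k (λ j → weight-coeff (linked k i j) (wordSeries k j) n m))
    qIf-zero : ∀ l m → qIf l (λ _ → + 0) m ≡ + 0
    qIf-zero true  zero    = ≡.refl
    qIf-zero true  (suc m) = ≡.refl
    qIf-zero false m       = ≡.refl
    first-letter : ∀ n m → 1# n m ℤ.+ sumℤ k (λ j → qIf (linked k i j) (wordSeries k j n) m) ≡ wordSeries k i (suc n) m
    first-letter zero    zero    = ≡.cong (λ z → + 1 ℤ.+ z) (sumℤ-zero k (λ j → qIf-zero (linked k i j) 0))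
    first-letter zero    (suc m) = ≡.cong (λ z → + 0 ℤ.+ z) (sumℤ-zero k (λ j → qIf-zero (linked k i j) (suc m)))
    first-letter (suc n) m       = ≡.trans (ℤₚ.+-identityˡ _) (≡.sym (∑ℤ≡sumℤ k _))

theorem4 : (k : ℕ) → Odd k → (n m : ℕ) → (GC k ⊗ Den k) n m ≡ Num k n m
theorem4 k (t , ≡.refl) = Bivariate.coeff₂ GC⊗Den≈Num
  where
  open Bivariate
  open AlternatingPolynomials
  open WordSeries
  open CommutativeRing ℤ⟦q⟧⟦x⟧.commutativeRing using (_+_; _*_; _-_; 1#; _≈_; setoid; trans; *-cong; +-cong; -‿cong)
  open Summation ℤ⟦q⟧⟦x⟧.commutativeRing using (∑; ∑-cong)
  open TransferIdentity ℤ⟦q⟧⟦x⟧.commutativeRing t using (transfer-identity)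
  open import Relation.Binary.Reasoning.Setoid setoid

  Den≈ : Den k ≈ P (ℕ.suc k) - x * ∑ k (λ j → P (ℕ.suc j))
  Den≈ = trans (⊖≈- (Num k) _)
    (+-cong (Num≈P t) (-‿cong (trans (⊗≈* X _) (*-cong X≈x (trans (sumS≈∑ k inner) (∑-cong k inner≈P))))))

  GC⊗Den≈Num : GC k ⊗ Den k ≈ Num k
  GC⊗Den≈Num = begin
    GC k ⊗ Den k
      ≈⟨ ⊗≈* (GC k) (Den k) ⟩
    GC k * Den k
      ≈⟨ *-cong (GC≈1+∑ k) Den≈ ⟩
    (1# + ∑ k (wordSeries k)) * (P (ℕ.suc k) - x * ∑ k (λ j → P (ℕ.suc j)))
      ≈⟨ transfer-identity x q bS P (wordSeries k) xq≈x+b P₁≈P₀ P-even P-odd (λ i _ → wordSeries-rec k i) ⟩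
    P (ℕ.suc k)
      ≈⟨ Num≈P t ⟨
    Num k ∎
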